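{- Let $A=(a_1,\ldots,a_m)$ be a tuple of positive integers and $\epsilon\in(0,2/7)$. If Algorithm PTAS (described in the context) outputs "A is unschedulable" on input $(A,\epsilon)$, then $A$ is unschedulable.
   Context: For a tuple $A$ of periods, $D(A)=\sum_i 1/a_i$. A schedule $\sigma:\mathbb{Z}\to[m]\cup\{\bot\}$ is valid for $A$ if for every set $I$ of $L$ consecutive integers and each task $i$, $|\sigma^{ -1}(\{i\})\cap I|\ge\lfloor L/a_i\rfloor$; $A$ is schedulable if a valid schedule exists; $\sigma$ is $p$-periodic if $\sigma(t)=\sigma(t+p)$ for all $t$; $\sigma(t)=\bot$ is a holiday. Algorithm PTAS, on input $A$ and $\epsilon\in(0,2/7)$: set $n=\lceil1/\epsilon\rceil$. If $D(A)>1$, output "A is unschedulable". Set $\ell=n$, $u=16n^2\ell^\ell$. Repeat: let $A_{\ell<j<u}$ be the list of periods in $A$ strictly between $\ell$ and $u$; if $D(A_{\ell<j<u})\le\frac{1}{2(n+1)}$ stop repeating; else set $\ell\gets u$, $u\gets16n^2\ell^\ell$. Let $A_{\rm big}$ be the periods of $A$ that are $\le\ell$ and $A_{\rm not\,big}$ those $>\ell$. Let $h_{\max}$ be the maximum, over all $p\in\{1,\ldots,\ell^\ell\}$ and all valid $p$-periodic schedules of $A_{\rm big}$, of the fraction of holidays in one period (and $0$ if there are none). If $h_{\max}<D(A_{\rm not\,big})$ output "A is unschedulable"; else output "$A(1+\epsilon)$ is schedulable".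
   Formalization: The parameter $\epsilon$ ranges only over the rationals in $(0,2/7)$. -}

module Defs where

open import Data.Nat as ℕ using (ℕ; zero; suc; _^_; _≤?_; _<?_)
import Data.Nat.DivMod as ℕD
open import Data.Integer as ℤ using (ℤ; +_)
open import Data.Rational as ℚ using (ℚ; 0ℚ; 1ℚ; 1/_; ceiling)
open import Data.Rational.Base using (>-nonZero)
open import Data.Fin as Fin using (Fin)
open import Data.Maybe using (Maybe; just; nothing)
open import Data.List using (List; length; lookup; filter; foldr)
open import Data.Product using (Σ; ∃; _×_; _,_)
open import Data.Sum using (_⊎_)
open import Relation.Nullary using (¬_; yes; no)
open import Relation.Nullary.Decidable using (_×-dec_)
open import Relation.Binary.PropositionalEquality using (_≡_)

-- A tuple of periods is a list of naturals; tasks are indices Fin (length A).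
-- (Positivity of periods is a separate hypothesis in the theorem.)
Periods : Set
Periods = List ℕ

Task : Periods → Set
Task A = Fin (length A)

period : (A : Periods) → Task A → ℕ
period A i = lookup A i

-- 1/a as a rational (a = 0 never occurs under the positivity hypothesis)
inv : ℕ → ℚ
inv zero    = 0ℚ
inv (suc k) = + 1 ℚ./ suc k

D : Periods → ℚ
D A = foldr (λ a r → inv a ℚ.+ r) 0ℚ A

-- ⌊ L / a ⌋ (a = 0 never occurs under the positivity hypothesis)
floorDiv : ℕ → ℕ → ℕ
floorDiv L zero    = 0
floorDiv L (suc k) = L ℕD./ suc k

-- schedule σ : ℤ → [m] ∪ {⊥}, with ⊥ (a holiday) rendered as nothing
Schedule : ℕ → Set
Schedule m = ℤ → Maybe (Fin m)

countTask : ∀ {m} → Schedule m → Fin m → ℤ → ℕ → ℕ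
countTask σ i s zero = 0
countTask σ i s (suc L) with σ s
... | nothing = countTask σ i (s ℤ.+ + 1) L
... | just j with j Fin.≟ i
...   | yes _ = suc (countTask σ i (s ℤ.+ + 1) L)
...   | no  _ = countTask σ i (s ℤ.+ + 1) L

countHolidays : ∀ {m} → Schedule m → ℤ → ℕ → ℕ
countHolidays σ s zero = 0
countHolidays σ s (suc L) with σ s
... | nothing = suc (countHolidays σ (s ℤ.+ + 1) L)
... | just _  = countHolidays σ (s ℤ.+ + 1) L

Valid : (A : Periods) → Schedule (length A) → Set
Valid A σ = ∀ (s : ℤ) (L : ℕ) (i : Task A) →
  floorDiv L (period A i) ℕ.≤ countTask σ i s L

Schedulable : Periods → Set
Schedulable A = Σ (Schedule (length A)) λ σ → Valid A σ

Periodic : ∀ {m} → ℕ → Schedule m → Set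
Periodic p σ = ∀ (t : ℤ) → σ t ≡ σ (t ℤ.+ + p)

holidayFraction : ∀ {m} → (p : ℕ) → Schedule m → ℚ
holidayFraction zero    σ = 0ℚ
holidayFraction (suc k) σ = + countHolidays σ (+ 0) (suc k) ℚ./ suc k

Candidate : (B : Periods) → (P p : ℕ) → Schedule (length B) → Set
Candidate B P p σ = (1 ℕ.≤ p) × (p ℕ.≤ P) × Periodic p σ × Valid B σ

IsHMax : (B : Periods) → (P : ℕ) → ℚ → Set
IsHMax B P h =
  ((¬ Σ ℕ λ p → Σ (Schedule (length B)) λ σ → Candidate B P p σ) × (h ≡ 0ℚ))
  ⊎ ((Σ ℕ λ p → Σ (Schedule (length B)) λ σ →
        Candidate B P p σ × (holidayFraction p σ ≡ h))
     × (∀ p σ → Candidate B P p σ → holidayFraction p σ ℚ.≤ h))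

nOf : (ε : ℚ) → 0ℚ ℚ.< ε → ℕ
nOf ε pos = ℤ.∣ ceiling ((1/ ε) {{>-nonZero pos}}) ∣

-- the sequence of values of ℓ in the loop: ℓ₀ = n, ℓ_{k+1} = 16 n² ℓ_k^{ℓ_k}
-- (in iteration k, ℓ = ℓ_k and u = ℓ_{k+1})
ℓseq : ℕ → ℕ → ℕ
ℓseq n zero    = n
ℓseq n (suc k) = 16 ℕ.* (n ℕ.* n) ℕ.* (ℓseq n k ^ ℓseq n k)

between : ℕ → ℕ → Periods → Periods
between l u A = filter (λ a → (l <? a) ×-dec (a <? u)) A

-- the stopping condition of iteration k: D(A_{ℓ<j<u}) ≤ 1/(2(n+1)); note suc (n + suc n) = 2(n+1)
Stops : ℕ → Periods → ℕ → Set
Stops n A k = D (between (ℓseq n k) (ℓseq n (suc k)) A) ℚ.≤ (+ 1 ℚ./ suc (n ℕ.+ suc n))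

LoopStopsAt : ℕ → Periods → ℕ → Set
LoopStopsAt n A k = Stops n A k × (∀ k′ → k′ ℕ.< k → ¬ Stops n A k′)

Abig : ℕ → Periods → Periods
Abig l A = filter (λ a → a ≤? l) A

AnotBig : ℕ → Periods → Periods
AnotBig l A = filter (λ a → l <? a) A

PTASOutputsUnschedulable : (A : Periods) → (ε : ℚ) → 0ℚ ℚ.< ε → Set
PTASOutputsUnschedulable A ε pos =
  (1ℚ ℚ.< D A)
  ⊎ ((D A ℚ.≤ 1ℚ) × Σ ℕ λ k → Σ ℚ λ h →
       LoopStopsAt (nOf ε pos) A k
     × IsHMax (Abig (ℓseq (nOf ε pos) k) A) (ℓseq (nOf ε pos) k ^ ℓseq (nOf ε pos) k) h
     × (h ℚ.< D (AnotBig (ℓseq (nOf ε pos) k) A)))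

-- Both outputs come from counting the slots of a valid schedule σ in long windows. If D(A) > 1, a
-- window of length Π aᵢ must hold Σᵢ Π aᵢ / aᵢ > Π aᵢ task slots. Otherwise read σ on ℕ and turn the
-- slots of the tasks with period > ℓ into holidays: a window of length L then holds at least about
-- L · D(A_not big) holidays. Every task of A_big still occurs in every window of its period length,
-- and this survives cutting the sequence between two positions whose next ℓ ∸ 1 slots agree. There
-- are at most (|A_big| + 1)^(ℓ ∸ 1) ≤ ℓ^ℓ such windows, so by pigeonhole a long prefix splits into
-- cycles of length ≤ ℓ^ℓ plus a rest of length ≤ ℓ^ℓ. Unrolled, each cycle is a valid periodic
-- schedule of A_big, so its holiday density is at most h_max < D(A_not big): too few holidays.

module Submission where

open import Defs
open import Data.Nat using (ℕ; _<_)
open import Data.Rational using (ℚ; 0ℚ; _/_) renaming (_<_ to _<ℚ_)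
open import Data.Integer using (+_)
open import Data.List using (List)
open import Data.List.Relation.Unary.All using (All)
open import Relation.Nullary using (¬_)

open import Data.Fin as Fin using (Fin; zero; suc)
import Data.Fin.Properties as Fin
open import Data.Integer as ℤ using (ℤ; -[1+_])
import Data.Integer.Properties as ℤₚ
open import Data.List using ([]; _∷_; length; lookup; filter; map)
open import Data.List.Relation.Unary.All as All using ([]; _∷_)
open import Data.List.Membership.Propositional.Properties using (∈-lookup)
open import Data.List.Relation.Unary.All.Properties using (all-filter; filter⁺)
open import Data.Maybe as Maybe using (Maybe; just; nothing; maybe′; _>>=_)
open import Data.Nat
  using (zero; suc; pred; _+_; _*_; _∸_; _^_; _≤_; z≤n; s≤s; z<s; s<s; _≤?_; _<?_; NonZero; >-nonZero; >-nonZero⁻¹)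
open import Data.Nat.Properties
open import Data.Nat.Induction using (<-rec)
open import Data.Nat.Tactic.RingSolver using (solve-∀)
open import Algebra.Properties.CommutativeSemigroup +-commutativeSemigroup
  using (xy∙z≈xz∙y; x∙yz≈xz∙y)
open import Algebra.Properties.CommutativeSemigroup *-commutativeSemigroup using ()
  renaming (x∙yz≈y∙xz to x*[y*z]≡y*[x*z]; x∙yz≈yx∙z to x*[y*z]≡[y*x]*z)
open import Data.Nat.ListAction using (sum; product)
open import Data.Nat.ListAction.Properties using (product≢0)
open import Algebra.Properties.CommutativeMonoid.Sum +-0-commutativeMonoid
  using (sum-syntax; ∑-distrib-+; sum-cong-≗; sum-replicate-zero)
import Data.Nat.DivMod as ℕ
open import Data.Nat.DivMod using (_%_)
import Data.Rational as ℚ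
open import Data.Rational using (toℚᵘ)
import Data.Rational.Properties as ℚₚ
open import Data.Rational.Unnormalised as ℚᵘ using (mkℚᵘ)
import Data.Rational.Unnormalised.Properties as ℚᵘ
open import Data.Product using (Σ; ∃; ∃₂; _,_; _×_)
open import Data.Sum using (inj₁; inj₂)
open import Function using (_∘_)
open import Relation.Binary.PropositionalEquality
open import Relation.Nullary using (Dec; yes; no; contradiction)
open import Relation.Unary using (Decidable)

-- Windowed sums

∑-mono-≤ : ∀ {m} {f g : Fin m → ℕ} → (∀ i → f i ≤ g i) → ∑[ i < m ] f i ≤ ∑[ i < m ] g i
∑-mono-≤ {zero}  f≤g = z≤n
∑-mono-≤ {suc m} f≤g = +-mono-≤ (f≤g zero) (∑-mono-≤ (f≤g ∘ suc))

∑-const-1 : ∀ m → ∑[ i < m ] 1 ≡ m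
∑-const-1 zero    = refl
∑-const-1 (suc m) = cong suc (∑-const-1 m)

∑-lookup : ∀ (G : ℕ → ℕ) xs → ∑[ i < length xs ] G (lookup xs i) ≡ sum (map G xs)
∑-lookup G []       = refl
∑-lookup G (x ∷ xs) = cong (_+_ (G x)) (∑-lookup G xs)

windowSum : (ℕ → ℕ) → ℕ → ℕ → ℕ
windowSum w s zero    = 0
windowSum w s (suc L) = w s + windowSum w (suc s) L

windowSum-++ : ∀ w s a b → windowSum w s (a + b) ≡ windowSum w s a + windowSum w (s + a) b
windowSum-++ w s zero    b = cong (λ t → windowSum w t b) (sym (+-identityʳ s))
windowSum-++ w s (suc a) b rewrite windowSum-++ w (suc s) a b | +-suc s a =
  sym (+-assoc (w s) _ _)

windowSum-cong : ∀ {w v} s t L → (∀ r → r < L → w (s + r) ≡ v (t + r)) →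
                 windowSum w s L ≡ windowSum v t L
windowSum-cong s t zero    _  = refl
windowSum-cong {w} {v} s t (suc L) w≡v = cong₂ _+_ head (windowSum-cong (suc s) (suc t) L tail)
  where
  head : w s ≡ v t
  head = subst₂ (λ x y → w x ≡ v y) (+-identityʳ s) (+-identityʳ t) (w≡v 0 z<s)
  tail : ∀ r → r < L → w (suc s + r) ≡ v (suc t + r)
  tail r r<L = subst₂ (λ x y → w x ≡ v y) (+-suc s r) (+-suc t r) (w≡v (suc r) (s<s r<L))

windowSum-mono-≤ : ∀ {w v} → (∀ t → w t ≤ v t) → ∀ s L → windowSum w s L ≤ windowSum v s L
windowSum-mono-≤ w≤v s zero    = z≤n
windowSum-mono-≤ w≤v s (suc L) = +-mono-≤ (w≤v s) (windowSum-mono-≤ w≤v (suc s) L)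

windowSum-monoʳ-≤ : ∀ w s {a b} → a ≤ b → windowSum w s a ≤ windowSum w s b
windowSum-monoʳ-≤ w s {a} a≤b with m≤n⇒∃[o]m+o≡n a≤b
... | o , refl rewrite windowSum-++ w s a o = m≤m+n _ _

windowSum-≤-length : ∀ {w} → (∀ t → w t ≤ 1) → ∀ s L → windowSum w s L ≤ L
windowSum-≤-length w≤1 s zero    = z≤n
windowSum-≤-length w≤1 s (suc L) = +-mono-≤ (w≤1 s) (windowSum-≤-length w≤1 (suc s) L)

windowSum-*ˡ : ∀ c w s L → windowSum (λ t → c * w t) s L ≡ c * windowSum w s L
windowSum-*ˡ c w s zero    = sym (*-zeroʳ c)
windowSum-*ˡ c w s (suc L) =
  trans (cong (_+_ (c * w s)) (windowSum-*ˡ c w (suc s) L)) (sym (*-distribˡ-+ c _ _))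

∑-windowSum : ∀ {m} (w : Fin m → ℕ → ℕ) s L →
              ∑[ i < m ] windowSum (w i) s L ≡ windowSum (λ t → ∑[ i < m ] w i t) s L
∑-windowSum {m} w s zero    = sum-replicate-zero m
∑-windowSum     w s (suc L) =
  trans (∑-distrib-+ (λ i → w i s) (λ i → windowSum (w i) (suc s) L))
        (cong (_+_ (∑[ i < _ ] w i s)) (∑-windowSum w (suc s) L))

windowSum-/ : ∀ {w} a .{{_ : NonZero a}} → (∀ s → 1 ≤ windowSum w s a) →
              ∀ s L → L ℕ./ a ≤ windowSum w s L
windowSum-/ {w} a hit s L = begin
  L ℕ./ a                        ≤⟨ multiples (L ℕ./ a) s ⟩
  windowSum w s (L ℕ./ a * a)    ≤⟨ windowSum-monoʳ-≤ w s (ℕ.m/n*n≤m L a) ⟩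
  windowSum w s L                ∎
  where
  open ≤-Reasoning
  multiples : ∀ q s → q ≤ windowSum w s (q * a)
  multiples zero    s = z≤n
  multiples (suc q) s = begin
    suc q                                         ≤⟨ +-mono-≤ (hit s) (multiples q (s + a)) ⟩
    windowSum w s a + windowSum w (s + a) (q * a) ≡⟨ windowSum-++ w s a (q * a) ⟨
    windowSum w s (a + q * a)                     ∎

-- Schedules as sequences on ℕ

-- By recursion on both arguments rather than via Fin._≟_, so that it computes under suc.
δ : ∀ {m} → Fin m → Fin m → ℕ
δ zero    zero    = 1
δ zero    (suc _) = 0
δ (suc _) zero    = 0
δ (suc i) (suc j) = δ i j

δ-refl : ∀ {m} (i : Fin m) → δ i i ≡ 1
δ-refl zero    = refl
δ-refl (suc i) = δ-refl i

δ-≢ : ∀ {m} {i j : Fin m} → i ≢ j → δ i j ≡ 0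
δ-≢ {i = zero}  {zero}  i≢j = contradiction refl i≢j
δ-≢ {i = zero}  {suc j} i≢j = refl
δ-≢ {i = suc i} {zero}  i≢j = refl
δ-≢ {i = suc i} {suc j} i≢j = δ-≢ (i≢j ∘ cong suc)

∑-δ : ∀ {m} (c : Fin m → ℕ) k → ∑[ i < m ] (c i * δ k i) ≡ c k
∑-δ {suc m} c zero = begin
  c zero * 1 + ∑[ i < m ] (c (suc i) * 0) ≡⟨ cong₂ _+_ (*-identityʳ (c zero)) (sum-cong-≗ (*-zeroʳ ∘ c ∘ suc)) ⟩
  c zero + ∑[ i < m ] 0                   ≡⟨ cong (_+_ (c zero)) (sum-replicate-zero m) ⟩
  c zero + 0                              ≡⟨ +-identityʳ (c zero) ⟩
  c zero                                  ∎
  where open ≡-Reasoning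
∑-δ {suc m} c (suc k) =
  trans (cong (_+ ∑[ i < m ] (c (suc i) * δ k i)) (*-zeroʳ (c zero))) (∑-δ (c ∘ suc) k)

occurs : ∀ {m} → Fin m → Maybe (Fin m) → ℕ
occurs i = maybe′ (λ j → δ j i) 0

isHoliday : ∀ {A : Set} → Maybe A → ℕ
isHoliday = maybe′ (λ _ → 0) 1

isHoliday-≤-1 : ∀ {A : Set} (x : Maybe A) → isHoliday x ≤ 1
isHoliday-≤-1 nothing  = ≤-refl
isHoliday-≤-1 (just _) = z≤n

∑-occurs : ∀ {m} (c : Fin m → ℕ) x → ∑[ i < m ] (c i * occurs i x) ≡ maybe′ c 0 x
∑-occurs {m} c nothing  = trans (sum-cong-≗ (*-zeroʳ ∘ c)) (sum-replicate-zero m)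
∑-occurs     c (just k) = ∑-δ c k

∑-windowSum-occurs : ∀ {m} (c : Fin m → ℕ) g s L →
  ∑[ i < m ] (c i * windowSum (occurs i ∘ g) s L) ≡ windowSum (maybe′ c 0 ∘ g) s L
∑-windowSum-occurs {m} c g s L = begin
  ∑[ i < m ] (c i * windowSum (occurs i ∘ g) s L)
    ≡⟨ sum-cong-≗ (λ i → windowSum-*ˡ (c i) (occurs i ∘ g) s L) ⟨
  ∑[ i < m ] windowSum (λ t → c i * occurs i (g t)) s L
    ≡⟨ ∑-windowSum (λ i t → c i * occurs i (g t)) s L ⟩
  windowSum (λ t → ∑[ i < m ] (c i * occurs i (g t))) s L
    ≡⟨ windowSum-cong s s L (λ r _ → ∑-occurs c (g (s + r))) ⟩
  windowSum (maybe′ c 0 ∘ g) s L ∎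
  where open ≡-Reasoning

occurs-remap : ∀ {m n} {r : Fin m → Maybe (Fin n)} {i j} → r i ≡ just j →
               ∀ x → occurs i x ≤ occurs j (x >>= r)
occurs-remap         r[i]≡j nothing  = z≤n
occurs-remap {i = i} {j} r[i]≡j (just k) with k Fin.≟ i
... | yes refl rewrite r[i]≡j | δ-refl k | δ-refl j = ≤-refl
... | no  k≢i  rewrite δ-≢ k≢i = z≤n

record Agree {A : Set} (σ : ℤ → A) (z : ℤ) (g : ℕ → A) (n : ℕ) : Set where
  constructor agree
  field at : ∀ r → σ (z ℤ.+ + r) ≡ g (n + r)

module _ {A : Set} {σ : ℤ → A} {z g n} (σ≈g : Agree σ z g n) where
  open Agree σ≈g

  agree-head : σ z ≡ g n
  agree-head = subst₂ (λ x y → σ x ≡ g y) (ℤₚ.+-identityʳ z) (+-identityʳ n) (at 0)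

  agree-tail : Agree σ (z ℤ.+ + 1) g (suc n)
  agree-tail = agree λ r →
    subst₂ (λ x y → σ x ≡ g y) (sym (ℤₚ.+-assoc z (+ 1) (+ r))) (+-suc n r) (at (suc r))

agree-onℕ : ∀ {A : Set} (σ : ℤ → A) s → Agree σ (+ s) (σ ∘ +_) s
agree-onℕ σ s = agree λ _ → refl

countTask-suc : ∀ {m} (σ : Schedule m) i z L →
                countTask σ i z (suc L) ≡ occurs i (σ z) + countTask σ i (z ℤ.+ + 1) L
countTask-suc σ i z L with σ z
... | nothing = refl
... | just j with j Fin.≟ i
...   | yes refl rewrite δ-refl j = refl
...   | no  j≢i  rewrite δ-≢ j≢i  = refl

countHolidays-suc : ∀ {m} (σ : Schedule m) z L →
                    countHolidays σ z (suc L) ≡ isHoliday (σ z) + countHolidays σ (z ℤ.+ + 1) L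
countHolidays-suc σ z L with σ z
... | nothing = refl
... | just _  = refl

countTask-windowSum : ∀ {m} {σ : Schedule m} {z g n} → Agree σ z g n →
                      ∀ i L → countTask σ i z L ≡ windowSum (occurs i ∘ g) n L
countTask-windowSum _ i zero = refl
countTask-windowSum {σ = σ} {z} σ≈g i (suc L) = trans (countTask-suc σ i z L)
  (cong₂ _+_ (cong (occurs i) (agree-head σ≈g)) (countTask-windowSum (agree-tail σ≈g) i L))

countHolidays-windowSum : ∀ {m} {σ : Schedule m} {z g n} → Agree σ z g n →
                          ∀ L → countHolidays σ z L ≡ windowSum (isHoliday ∘ g) n L
countHolidays-windowSum _ zero = refl
countHolidays-windowSum {σ = σ} {z} σ≈g (suc L) = trans (countHolidays-suc σ z L)
  (cong₂ _+_ (cong isHoliday (agree-head σ≈g)) (countHolidays-windowSum (agree-tail σ≈g) L))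

Dense : ∀ {m} → (Fin m → ℕ) → (ℕ → Maybe (Fin m)) → Set
Dense a g = ∀ j s → 1 ≤ windowSum (occurs j ∘ g) s (a j)

valid⇒windowSum : ∀ {A} {σ : Schedule (length A)} → Valid A σ → ∀ i s L →
                  floorDiv L (period A i) ≤ windowSum (occurs i ∘ σ ∘ +_) s L
valid⇒windowSum {σ = σ} valid i s L =
  subst (_ ≤_) (countTask-windowSum (agree-onℕ σ s) i L) (valid (+ s) L i)

valid⇒dense : ∀ {A σ} → All (0 <_) A → Valid A σ → Dense (period A) (σ ∘ +_)
valid⇒dense {A} A⁺ valid j s
  with period A j | All.lookup A⁺ (∈-lookup j) | valid⇒windowSum {A} valid j s (period A j)
... | suc a | _ | bound = ≤-trans (≤-reflexive (sym (ℕ.n/n≡1 (suc a)))) bound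

dense⇒floorDiv≤ : ∀ {B : Periods} (g : ℕ → Maybe (Fin (length B))) → All (0 <_) B →
                  Dense (period B) g → ∀ j s L → floorDiv L (period B j) ≤ windowSum (occurs j ∘ g) s L
dense⇒floorDiv≤ {B} g B⁺ dense j s L with period B j | All.lookup B⁺ (∈-lookup j) | dense j
... | suc a | _ | hit = windowSum-/ (suc a) hit s L

dense⇒valid : ∀ {B : Periods} {τ} (g : ℕ → Maybe (Fin (length B))) → All (0 <_) B →
              Dense (period B) g → (∀ z → Σ ℕ (Agree τ z g)) → Valid B τ
dense⇒valid g B⁺ dense τ≈g z L j with τ≈g z
... | n , τ≈g-from-z =
  subst (_ ≤_) (sym (countTask-windowSum τ≈g-from-z j L)) (dense⇒floorDiv≤ g B⁺ dense j n L)

valid⇒∑-floorDiv≤ : ∀ {A} {σ : Schedule (length A)} → Valid A σ → ∀ (c : Task A → ℕ) s L →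
  ∑[ i < length A ] (c i * floorDiv L (period A i)) ≤ windowSum (maybe′ c 0 ∘ σ ∘ +_) s L
valid⇒∑-floorDiv≤ {A} {σ} valid c s L = begin
  ∑[ i < length A ] (c i * floorDiv L (period A i))
    ≤⟨ ∑-mono-≤ (λ i → *-monoʳ-≤ (c i) (valid⇒windowSum {A} valid i s L)) ⟩
  ∑[ i < length A ] (c i * windowSum (occurs i ∘ σ ∘ +_) s L)
    ≡⟨ ∑-windowSum-occurs c (σ ∘ +_) s L ⟩
  windowSum (maybe′ c 0 ∘ σ ∘ +_) s L ∎
  where open ≤-Reasoning

maybe′-1-≤-1 : ∀ {A : Set} (x : Maybe A) → maybe′ (λ _ → 1) 0 x ≤ 1
maybe′-1-≤-1 nothing  = z≤n
maybe′-1-≤-1 (just _) = ≤-refl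

dense⇒tasks≤ : ∀ {m} {a : Fin m → ℕ} g l → Dense a g → (∀ j → a j ≤ l) → m ≤ l
dense⇒tasks≤ {m} {a} g l dense a≤l = begin
  m                                             ≡⟨ ∑-const-1 m ⟨
  ∑[ j < m ] 1                                  ≤⟨ ∑-mono-≤ hit ⟩
  ∑[ j < m ] (1 * windowSum (occurs j ∘ g) 0 l) ≡⟨ ∑-windowSum-occurs (λ _ → 1) g 0 l ⟩
  windowSum (maybe′ (λ _ → 1) 0 ∘ g) 0 l        ≤⟨ windowSum-≤-length (maybe′-1-≤-1 ∘ g) 0 l ⟩
  l                                             ∎
  where
  open ≤-Reasoning
  hit : ∀ j → 1 ≤ 1 * windowSum (occurs j ∘ g) 0 l
  hit j = ≤-trans (dense j 0)
            (≤-trans (windowSum-monoʳ-≤ _ 0 (a≤l j)) (≤-reflexive (sym (*-identityˡ _))))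

-- D as a fraction

-- Σᵢ Πⱼ≠ᵢ bⱼ, so that D B = D-numerator B / product B.
D-numerator : List ℕ → ℕ
D-numerator []      = 0
D-numerator (b ∷ B) = product B + b * D-numerator B

product-positive : ∀ {B} → All (0 <_) B → 0 < product B
product-positive {B} B⁺ = >-nonZero⁻¹ (product B) {{product≢0 (All.map >-nonZero B⁺)}}

1/[1+β]+a/[1+m] : ∀ β a m →
  mkℚᵘ (+ 1) β ℚᵘ.+ mkℚᵘ (+ a) m ℚᵘ.≃ mkℚᵘ (+ (suc m + suc β * a)) (pred (suc β * suc m))
1/[1+β]+a/[1+m] β a m = ℚᵘ.*≡* (cong (ℤ._* + suc (m + β * suc m)) (begin
  + 1 ℤ.* + suc m ℤ.+ + a ℤ.* + suc β
    ≡⟨ cong₂ ℤ._+_ (ℤₚ.*-identityˡ (+ suc m)) (sym (ℤₚ.pos-* a (suc β))) ⟩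
  + suc m ℤ.+ + (a * suc β)           ≡⟨ ℤₚ.pos-+ (suc m) (a * suc β) ⟨
  + (suc m + a * suc β)               ≡⟨ cong (λ x → + (suc m + x)) (*-comm a (suc β)) ⟩
  + (suc m + suc β * a)               ∎))
  where open ≡-Reasoning

toℚᵘ-D : ∀ {B} → All (0 <_) B → toℚᵘ (D B) ℚᵘ.≃ mkℚᵘ (+ D-numerator B) (pred (product B))
toℚᵘ-D []                  = ℚᵘ.≃-refl
toℚᵘ-D {suc β ∷ B} (_ ∷ B⁺) with product B | product-positive B⁺ | toℚᵘ-D B⁺
... | suc m | _ | D[B]≃ = begin
  toℚᵘ (inv (suc β) ℚ.+ D B)                 ≈⟨ ℚₚ.toℚᵘ-homo-+ (inv (suc β)) (D B) ⟩
  toℚᵘ (inv (suc β)) ℚᵘ.+ toℚᵘ (D B)         ≈⟨ ℚᵘ.+-cong (ℚₚ.toℚᵘ-fromℚᵘ (mkℚᵘ (+ 1) β)) D[B]≃ ⟩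
  mkℚᵘ (+ 1) β ℚᵘ.+ mkℚᵘ (+ D-numerator B) m ≈⟨ 1/[1+β]+a/[1+m] β (D-numerator B) m ⟩
  mkℚᵘ (+ (suc m + suc β * D-numerator B)) (pred (suc β * suc m)) ∎
  where open ℚᵘ.≃-Reasoning

<D⇒product*<D-numerator* : ∀ {B} → All (0 <_) B → ∀ c n →
                           + c / suc n <ℚ D B → product B * c < D-numerator B * suc n
<D⇒product*<D-numerator* {B} B⁺ c n c/n<D
  with product B | product-positive B⁺ | toℚᵘ-D B⁺
... | suc m | _ | D[B]≃
  with ℚᵘ.<-respʳ-≃ D[B]≃ (ℚᵘ.<-respˡ-≃ (ℚₚ.toℚᵘ-fromℚᵘ (mkℚᵘ (+ c) n)) (ℚₚ.toℚᵘ-mono-< c/n<D))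
... | ℚᵘ.*<* c[1+m]<num[1+n] = subst (_< D-numerator B * suc n) (*-comm c (suc m))
  (ℤₚ.drop‿+<+ (subst₂ ℤ._<_ (sym (ℤₚ.pos-* c (suc m))) (sym (ℤₚ.pos-* (D-numerator B) (suc n)))
                              c[1+m]<num[1+n]))

sum-floorDiv-product : ∀ {B} → All (0 <_) B → ∀ c →
                       sum (map (floorDiv (c * product B)) B) ≡ c * D-numerator B
sum-floorDiv-product []                   c = sym (*-zeroʳ c)
sum-floorDiv-product {suc β ∷ B} (_ ∷ B⁺) c = begin
  floorDiv (c * (suc β * product B)) (suc β) + sum (map (floorDiv (c * (suc β * product B))) B)
    ≡⟨ cong₂ _+_ c[1+β]P/[1+β]
                 (trans (cong (λ x → sum (map (floorDiv x) B)) (sym (*-assoc c (suc β) (product B))))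
                        (sum-floorDiv-product B⁺ (c * suc β))) ⟩
  c * product B + c * suc β * D-numerator B
    ≡⟨ cong (_+_ (c * product B)) (*-assoc c (suc β) (D-numerator B)) ⟩
  c * product B + c * (suc β * D-numerator B)
    ≡⟨ *-distribˡ-+ c (product B) (suc β * D-numerator B) ⟨
  c * (product B + suc β * D-numerator B) ∎
  where
  open ≡-Reasoning
  c[1+β]P/[1+β] : c * (suc β * product B) ℕ./ suc β ≡ c * product B
  c[1+β]P/[1+β] = begin
    c * (suc β * product B) ℕ./ suc β ≡⟨ cong (λ x → c * x ℕ./ suc β) (*-comm (suc β) (product B)) ⟩
    c * (product B * suc β) ℕ./ suc β ≡⟨ cong (ℕ._/ suc β) (*-assoc c (product B) (suc β)) ⟨
    c * product B * suc β ℕ./ suc β   ≡⟨ ℕ.m*n/n≡m (c * product B) (suc β) ⟩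
    c * product B                     ∎

D>1⇒unschedulable : ∀ {A} → All (0 <_) A → ℚ.1ℚ <ℚ D A → ¬ Schedulable A
D>1⇒unschedulable {A} A⁺ 1<D (σ , valid) = <⇒≱ product<D-numerator (begin
  D-numerator A                                   ≡⟨ *-identityˡ (D-numerator A) ⟨
  1 * D-numerator A                               ≡⟨ sum-floorDiv-product A⁺ 1 ⟨
  sum (map (floorDiv M) A)                        ≡⟨ ∑-lookup (floorDiv M) A ⟨
  ∑[ i < length A ] floorDiv M (period A i)       ≡⟨ sum-cong-≗ (λ i → *-identityˡ (floorDiv M (period A i))) ⟨
  ∑[ i < length A ] (1 * floorDiv M (period A i)) ≤⟨ valid⇒∑-floorDiv≤ {A} valid (λ _ → 1) 0 M ⟩
  windowSum (maybe′ (λ _ → 1) 0 ∘ σ ∘ +_) 0 M     ≤⟨ windowSum-≤-length (maybe′-1-≤-1 ∘ σ ∘ +_) 0 M ⟩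
  M                                               ≡⟨ *-identityˡ (product A) ⟩
  product A                                       ∎)
  where
  open ≤-Reasoning
  M = 1 * product A
  product<D-numerator : product A < D-numerator A
  product<D-numerator = subst₂ _<_ (*-identityʳ _) (*-identityʳ _) (<D⇒product*<D-numerator* A⁺ 1 0 1<D)

-- Big tasks

iverson : ∀ {P : Set} → Dec P → ℕ
iverson (yes _) = 1
iverson (no  _) = 0

module _ {A : Set} {P : A → Set} (P? : Decidable P) where

  filterIndex : ∀ xs → Fin (length xs) → Maybe (Fin (length (filter P? xs)))
  filterIndex (x ∷ xs) i with P? x
  filterIndex (x ∷ xs) zero    | yes _ = just zero
  filterIndex (x ∷ xs) (suc i) | yes _ = Maybe.map suc (filterIndex xs i)
  filterIndex (x ∷ xs) zero    | no  _ = nothing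
  filterIndex (x ∷ xs) (suc i) | no  _ = filterIndex xs i

  lookup-filterIndex : ∀ xs {i j} → filterIndex xs i ≡ just j → lookup (filter P? xs) j ≡ lookup xs i
  lookup-filterIndex (x ∷ xs) {i} eq with P? x
  lookup-filterIndex (x ∷ xs) {zero}  refl | yes _ = refl
  lookup-filterIndex (x ∷ xs) {suc i} eq   | yes _ with filterIndex xs i in eq′
  lookup-filterIndex (x ∷ xs) {suc i} refl | yes _ | just k = lookup-filterIndex xs eq′
  lookup-filterIndex (x ∷ xs) {zero}  ()   | no  _
  lookup-filterIndex (x ∷ xs) {suc i} eq   | no  _ = lookup-filterIndex xs eq

  filterIndex-just⇒P : ∀ xs {i j} → filterIndex xs i ≡ just j → P (lookup xs i)
  filterIndex-just⇒P (x ∷ xs) {i} eq with P? x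
  filterIndex-just⇒P (x ∷ xs) {zero}  refl | yes px = px
  filterIndex-just⇒P (x ∷ xs) {suc i} eq   | yes _ with filterIndex xs i in eq′
  filterIndex-just⇒P (x ∷ xs) {suc i} refl | yes _ | just k = filterIndex-just⇒P xs eq′
  filterIndex-just⇒P (x ∷ xs) {zero}  ()   | no  _
  filterIndex-just⇒P (x ∷ xs) {suc i} eq   | no  _ = filterIndex-just⇒P xs eq

  filterIndex-surjective : ∀ xs j → ∃ λ i → filterIndex xs i ≡ just j
  filterIndex-surjective (x ∷ xs) j with P? x
  filterIndex-surjective (x ∷ xs) zero    | yes _ = zero , refl
  filterIndex-surjective (x ∷ xs) (suc j) | yes _ with filterIndex-surjective xs j
  ... | i , eq = suc i , cong (Maybe.map suc) eq
  filterIndex-surjective (x ∷ xs) j       | no  _ with filterIndex-surjective xs j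
  ... | i , eq = suc i , eq

  ∑-filter : ∀ (G : A → ℕ) xs →
    ∑[ i < length xs ] (iverson (P? (lookup xs i)) * G (lookup xs i)) ≡ sum (map G (filter P? xs))
  ∑-filter G []       = refl
  ∑-filter G (x ∷ xs) with P? x
  ... | yes _ = cong₂ _+_ (+-identityʳ (G x)) (∑-filter G xs)
  ... | no  _ = ∑-filter G xs

periods-Abig≤ : ∀ l A j → period (Abig l A) j ≤ l
periods-Abig≤ l A j = All.lookup (all-filter (_≤? l) A) (∈-lookup j)

module _ (l : ℕ) {A : Periods} (A⁺ : All (0 <_) A) {σ : Schedule (length A)} (valid : Valid A σ) where

  bigPart : ℕ → Maybe (Fin (length (Abig l A)))
  bigPart t = σ (+ t) >>= filterIndex (_≤? l) A

  bigPart-dense : Dense (period (Abig l A)) bigPart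
  bigPart-dense j s with filterIndex-surjective (_≤? l) A j
  ... | i , i↦j = begin
    1                                                      ≤⟨ valid⇒dense A⁺ valid i s ⟩
    windowSum (occurs i ∘ σ ∘ +_) s (period A i)
      ≤⟨ windowSum-mono-≤ (occurs-remap i↦j ∘ σ ∘ +_) s (period A i) ⟩
    windowSum (occurs j ∘ bigPart) s (period A i)
      ≡⟨ cong (windowSum _ s) (lookup-filterIndex (_≤? l) A i↦j) ⟨
    windowSum (occurs j ∘ bigPart) s (period (Abig l A) j) ∎
    where open ≤-Reasoning

  length-Abig≤ : length (Abig l A) ≤ l
  length-Abig≤ = dense⇒tasks≤ bigPart l bigPart-dense (periods-Abig≤ l A)

  bigPart-holidays : ∀ L → sum (map (floorDiv L) (AnotBig l A)) ≤ windowSum (isHoliday ∘ bigPart) 0 L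
  bigPart-holidays L = begin
    sum (map (floorDiv L) (AnotBig l A))                      ≡⟨ ∑-filter (l <?_) (floorDiv L) A ⟨
    ∑[ i < length A ] (notBig i * floorDiv L (period A i))    ≤⟨ valid⇒∑-floorDiv≤ {A} valid notBig 0 L ⟩
    windowSum (maybe′ notBig 0 ∘ σ ∘ +_) 0 L                  ≤⟨ windowSum-mono-≤ (notBig≤holiday ∘ σ ∘ +_) 0 L ⟩
    windowSum (isHoliday ∘ bigPart) 0 L                       ∎
    where
    open ≤-Reasoning
    notBig : Task A → ℕ
    notBig i = iverson (l <? period A i)
    notBig≤holiday : ∀ x → maybe′ notBig 0 x ≤ isHoliday (x >>= filterIndex (_≤? l) A)
    notBig≤holiday nothing = z≤n
    notBig≤holiday (just i) with l <? period A i | filterIndex (_≤? l) A i in i↦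
    ... | no  _   | _       = z≤n
    ... | yes _   | nothing = ≤-refl
    ... | yes l<a | just _  = contradiction (filterIndex-just⇒P (_≤? l) A i↦) (<⇒≱ l<a)

-- Cycles

encode : ∀ {m} → Maybe (Fin m) → Fin (suc m)
encode = maybe′ suc zero

encode-injective : ∀ {m} {x y : Maybe (Fin m)} → encode x ≡ encode y → x ≡ y
encode-injective {x = nothing} {nothing} _    = refl
encode-injective {x = just _}  {just _}  refl = refl

-- The window f t, …, f (t + w ∸ 1) as a base-(m + 1) numeral, so that pigeonhole applies to windows.
windowCode : ∀ {m} → (ℕ → Maybe (Fin m)) → ℕ → (w : ℕ) → Fin (suc m ^ w)
windowCode f t zero    = zero
windowCode f t (suc w) = Fin.combine (encode (f t)) (windowCode f (suc t) w)

windowCode-injective : ∀ {m} (f g : ℕ → Maybe (Fin m)) {t u} w →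
  windowCode f t w ≡ windowCode g u w → ∀ r → r < w → f (t + r) ≡ g (u + r)
windowCode-injective f g {t} {u} (suc w) same r r<w
  with Fin.combine-injective (encode (f t)) _ (encode (g u)) _ same
windowCode-injective f g {t} {u} (suc w) same zero    _         | heads , _ =
  subst₂ (λ x y → f x ≡ g y) (sym (+-identityʳ t)) (sym (+-identityʳ u)) (encode-injective heads)
windowCode-injective f g {t} {u} (suc w) same (suc r) (s<s r<w) | _ , tails =
  subst₂ (λ x y → f x ≡ g y) (sym (+-suc t r)) (sym (+-suc u r)) (windowCode-injective f g w tails r r<w)

Repeats : ∀ {A : Set} → (ℕ → A) → (w i p : ℕ) → Set
Repeats f w i p = ∀ r → r < w → f (i + r) ≡ f (i + p + r)

cycle-exists : ∀ {m} (f : ℕ → Maybe (Fin m)) w →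
  ∃₂ λ i p → 0 < p × i + p ≤ suc m ^ w × Repeats f w i p
cycle-exists {m} f w with Fin.pigeonhole (n<1+n (suc m ^ w)) (λ t → windowCode f (Fin.toℕ t) w)
... | t , u , t<u , same with m≤n⇒∃[o]m+o≡n t<u
... | o , t+1+o≡u = Fin.toℕ t , suc o , z<s , i+p≤K , repeats
  where
  t+[1+o]≡u : Fin.toℕ t + suc o ≡ Fin.toℕ u
  t+[1+o]≡u = trans (+-suc (Fin.toℕ t) o) t+1+o≡u
  i+p≤K : Fin.toℕ t + suc o ≤ suc m ^ w
  i+p≤K = subst (_≤ suc m ^ w) (sym t+[1+o]≡u) (≤-pred (Fin.toℕ<n u))
  repeats : Repeats f w (Fin.toℕ t) (suc o)
  repeats = windowCode-injective f f w
    (subst (λ x → windowCode f (Fin.toℕ t) w ≡ windowCode f x w) (sym t+[1+o]≡u) same)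

excise : ∀ {A : Set} → (ℕ → A) → ℕ → ℕ → ℕ → A
excise f i p t with t <? i
... | yes _ = f t
... | no  _ = f (t + p)

module _ {A : Set} (f : ℕ → A) (i p : ℕ) where

  excise-< : ∀ {t} → t < i → excise f i p t ≡ f t
  excise-< {t} t<i with t <? i
  ... | yes _   = refl
  ... | no  t≮i = contradiction t<i t≮i

  excise-≥ : ∀ {t} → i ≤ t → excise f i p t ≡ f (t + p)
  excise-≥ {t} i≤t with t <? i
  ... | yes t<i = contradiction i≤t (<⇒≱ t<i)
  ... | no  _   = refl

  excise-agrees : ∀ {w t} → Repeats f w i p → t < i + w → excise f i p t ≡ f t
  excise-agrees {w} {t} repeats t<i+w with i ≤? t
  ... | no  i≰t = excise-< (≰⇒> i≰t)
  ... | yes i≤t with m≤n⇒∃[o]m+o≡n i≤t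
  ... | r , refl = begin
    excise f i p (i + r) ≡⟨ excise-≥ (m≤m+n i r) ⟩
    f (i + r + p)        ≡⟨ cong f (xy∙z≈xz∙y i r p) ⟩
    f (i + p + r)        ≡⟨ repeats r (+-cancelˡ-< i r w t<i+w) ⟨
    f (i + r)            ∎
    where open ≡-Reasoning

  windowSum-excise : ∀ (v : A → ℕ) R →
    windowSum (v ∘ f) 0 (i + p + R) ≡ windowSum (v ∘ excise f i p) 0 (i + R) + windowSum (v ∘ f) i p
  windowSum-excise v R = begin
    S 0 (i + p + R)                 ≡⟨ cong (S 0) (+-assoc i p R) ⟩
    S 0 (i + (p + R))               ≡⟨ windowSum-++ (v ∘ f) 0 i (p + R) ⟩
    S 0 i + S i (p + R)             ≡⟨ cong (_+_ (S 0 i)) (windowSum-++ (v ∘ f) i p R) ⟩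
    S 0 i + (S i p + S (i + p) R)   ≡⟨ x∙yz≈xz∙y (S 0 i) (S i p) (S (i + p) R) ⟩
    S 0 i + S (i + p) R + S i p     ≡⟨ cong (_+ S i p) (cong₂ _+_ before after) ⟨
    S′ 0 i + S′ i R + S i p         ≡⟨ cong (_+ S i p) (windowSum-++ (v ∘ excise f i p) 0 i R) ⟨
    S′ 0 (i + R) + S i p            ∎
    where
    open ≡-Reasoning
    S S′ : ℕ → ℕ → ℕ
    S  = windowSum (v ∘ f)
    S′ = windowSum (v ∘ excise f i p)
    before : S′ 0 i ≡ S 0 i
    before = windowSum-cong 0 0 i (λ r r<i → cong v (excise-< r<i))
    after : S′ i R ≡ S (i + p) R
    after = windowSum-cong i (i + p) R λ r _ →
      trans (cong v (excise-≥ (m≤m+n i r))) (cong (v ∘ f) (xy∙z≈xz∙y i r p))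

excise-dense : ∀ {m} {a : Fin m → ℕ} {w} → (∀ j → a j ≤ suc w) → ∀ f i p →
               Dense a f → Repeats f w i p → Dense a (excise f i p)
excise-dense {a = a} {w} a≤1+w f i p dense repeats j s with s <? i
... | yes s<i = subst (1 ≤_) (windowSum-cong s s (a j) agrees) (dense j s)
  where
  agrees : ∀ r → r < a j → occurs j (f (s + r)) ≡ occurs j (excise f i p (s + r))
  agrees r r<a = cong (occurs j) (sym (excise-agrees f i p repeats (begin-strict
    s + r      <⟨ +-monoʳ-< s r<a ⟩
    s + a j    ≤⟨ +-monoʳ-≤ s (a≤1+w j) ⟩
    s + suc w  ≡⟨ +-suc s w ⟩
    suc s + w  ≤⟨ +-monoˡ-≤ w s<i ⟩
    i + w      ∎)))
    where open ≤-Reasoning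
... | no s≮i = subst (1 ≤_) (windowSum-cong (s + p) s (a j) agrees) (dense j (s + p))
  where
  agrees : ∀ r → r < a j → occurs j (f (s + p + r)) ≡ occurs j (excise f i p (s + r))
  agrees r _ = cong (occurs j) (sym (trans (excise-≥ f i p (≤-trans (≮⇒≥ s≮i) (m≤m+n s r)))
                                            (cong f (xy∙z≈xz∙y s r p))))

%-cong-+ʳ : ∀ {a b} k p .{{_ : NonZero p}} → a % p ≡ b % p → (a + k) % p ≡ (b + k) % p
%-cong-+ʳ {a} {b} k p a≡b = begin
  (a + k) % p             ≡⟨ ℕ.%-distribˡ-+ a k p ⟩
  (a % p + k % p) % p     ≡⟨ cong (λ x → (x + k % p) % p) a≡b ⟩
  (b % p + k % p) % p     ≡⟨ ℕ.%-distribˡ-+ b k p ⟨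
  (b + k) % p             ∎
  where open ≡-Reasoning

module _ (p : ℕ) .{{_ : NonZero p}} where

  -- A natural number congruent to z modulo p; -[1+ n ] ≡ (p ∸ 1) * (n + 1).
  residue : ℤ → ℕ
  residue (+ n)    = n
  residue -[1+ n ] = pred p * suc n

  residue-suc : ∀ z → residue (z ℤ.+ + 1) % p ≡ (residue z + 1) % p
  residue-suc (+ n)        = refl
  residue-suc -[1+ zero ]  = begin
    0 % p                ≡⟨ ℕ.m<n⇒m%n≡m (>-nonZero⁻¹ p) ⟩
    0                    ≡⟨ ℕ.n%n≡0 p ⟨
    p % p                ≡⟨ cong (_% p) (trans (q*1+1≡1+q (pred p)) (suc-pred p)) ⟨
    (pred p * 1 + 1) % p ∎
    where
    open ≡-Reasoning
    q*1+1≡1+q : ∀ q → q * 1 + 1 ≡ suc q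
    q*1+1≡1+q = solve-∀
  residue-suc -[1+ suc n ] = begin
    pred p * suc n % p                  ≡⟨ ℕ.[m+n]%n≡m%n (pred p * suc n) p ⟨
    (pred p * suc n + p) % p            ≡⟨ cong (λ x → (pred p * suc n + x) % p) (suc-pred p) ⟨
    (pred p * suc n + suc (pred p)) % p ≡⟨ cong (_% p) (q[2+n]+1≡q[1+n]+1+q (pred p) n) ⟨
    (pred p * suc (suc n) + 1) % p      ∎
    where
    open ≡-Reasoning
    q[2+n]+1≡q[1+n]+1+q : ∀ q n → q * suc (suc n) + 1 ≡ q * suc n + suc q
    q[2+n]+1≡q[1+n]+1+q = solve-∀

  residue-+ : ∀ z r → residue (z ℤ.+ + r) % p ≡ (residue z + r) % p
  residue-+ z zero    =
    cong (_% p) (trans (cong residue (ℤₚ.+-identityʳ z)) (sym (+-identityʳ (residue z))))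
  residue-+ z (suc r) = begin
    residue (z ℤ.+ + suc r) % p         ≡⟨ cong (λ x → residue x % p) (ℤₚ.+-assoc z (+ 1) (+ r)) ⟨
    residue (z ℤ.+ + 1 ℤ.+ + r) % p     ≡⟨ residue-+ (z ℤ.+ + 1) r ⟩
    (residue (z ℤ.+ + 1) + r) % p       ≡⟨ %-cong-+ʳ r p (residue-suc z) ⟩
    (residue z + 1 + r) % p             ≡⟨ cong (_% p) (+-assoc (residue z) 1 r) ⟩
    (residue z + suc r) % p             ∎
    where open ≡-Reasoning

module PeriodicExtension (B : Periods) (f : ℕ → Maybe (Fin (length B)))
                         (w i p : ℕ) .{{_ : NonZero p}} (repeats : Repeats f w i p) where

  unrolled : ℕ → Maybe (Fin (length B))
  unrolled t = f (i + t % p)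

  unrolled-% : ∀ {s t} → s % p ≡ t % p → unrolled s ≡ unrolled t
  unrolled-% = cong (λ x → f (i + x))

  unrolled-agrees : ∀ t → t < p + w → unrolled t ≡ f (i + t)
  unrolled-agrees = <-rec (λ t → t < p + w → unrolled t ≡ f (i + t)) step
    where
    step : ∀ t → (∀ {t′} → t′ < t → t′ < p + w → unrolled t′ ≡ f (i + t′)) →
           t < p + w → unrolled t ≡ f (i + t)
    step t rec t<p+w with p ≤? t
    ... | no  p≰t = cong (λ x → f (i + x)) (ℕ.m<n⇒m%n≡m (≰⇒> p≰t))
    ... | yes p≤t with m≤n⇒∃[o]m+o≡n p≤t
    ... | t′ , refl = begin
      unrolled (p + t′)  ≡⟨ unrolled-% (trans (cong (_% p) (+-comm p t′)) (ℕ.[m+n]%n≡m%n t′ p)) ⟩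
      unrolled t′        ≡⟨ rec t′<p+t′ (<-trans t′<p+t′ t<p+w) ⟩
      f (i + t′)         ≡⟨ repeats t′ (+-cancelˡ-< p t′ w t<p+w) ⟩
      f (i + p + t′)     ≡⟨ cong f (+-assoc i p t′) ⟩
      f (i + (p + t′))   ∎
      where
      open ≡-Reasoning
      t′<p+t′ : t′ < p + t′
      t′<p+t′ = m<n+m t′ (>-nonZero⁻¹ p)

  unrolled-dense : (∀ j → period B j ≤ suc w) → Dense (period B) f → Dense (period B) unrolled
  unrolled-dense a≤1+w dense j s = subst (1 ≤_) (trans unroll wrap) (dense j (i + s % p))
    where
    unroll : windowSum (occurs j ∘ f) (i + s % p) (period B j) ≡ windowSum (occurs j ∘ unrolled) (s % p) (period B j)
    unroll = windowSum-cong (i + s % p) (s % p) (period B j) λ r r<a → cong (occurs j) (sym (trans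
      (unrolled-agrees (s % p + r) (+-mono-<-≤ (ℕ.m%n<n s p) (≤-pred (≤-trans r<a (a≤1+w j)))))
      (cong f (sym (+-assoc i (s % p) r)))))
    wrap : windowSum (occurs j ∘ unrolled) (s % p) (period B j) ≡ windowSum (occurs j ∘ unrolled) s (period B j)
    wrap = windowSum-cong (s % p) s (period B j) λ r _ →
      cong (occurs j) (unrolled-% (%-cong-+ʳ r p (ℕ.m%n%n≡m%n s p)))

  extension : Schedule (length B)
  extension z = unrolled (residue p z)

  extension-agrees : ∀ z → Agree extension z unrolled (residue p z)
  extension-agrees z = agree λ r → unrolled-% (residue-+ p z r)

  extension-periodic : Periodic p extension
  extension-periodic z = unrolled-% (sym (trans (residue-+ p z p) (ℕ.[m+n]%n≡m%n (residue p z) p)))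

  extension-valid : All (0 <_) B → (∀ j → period B j ≤ suc w) → Dense (period B) f → Valid B extension
  extension-valid B⁺ a≤1+w dense =
    dense⇒valid unrolled B⁺ (unrolled-dense a≤1+w dense) (λ z → residue p z , extension-agrees z)

  extension-holidays : countHolidays extension (+ 0) p ≡ windowSum (isHoliday ∘ f) i p
  extension-holidays = trans (countHolidays-windowSum (extension-agrees (+ 0)) p)
    (windowSum-cong 0 i p (λ r r<p → cong isHoliday (unrolled-agrees r (≤-trans r<p (m≤m+n p w)))))

segment-bound : ∀ {K P Q H c x p C} → p ≤ K → Q * c < P * p →
  K * Q * H + x ≤ K * P * x + C → K * Q * (H + c) + (x + p) ≤ K * P * (x + p) + C
segment-bound {K} {P} {Q} {H} {c} {x} {p} {C} p≤K Qc<Pp bound = begin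
  K * Q * (H + c) + (x + p)             ≡⟨ split K Q H c x p ⟩
  (K * Q * H + x) + (K * (Q * c) + p)   ≤⟨ +-mono-≤ bound (+-monoʳ-≤ (K * (Q * c)) p≤K) ⟩
  (K * P * x + C) + (K * (Q * c) + K)   ≡⟨ cong (_+_ (K * P * x + C)) (trans (+-comm _ K) (sym (*-suc K (Q * c)))) ⟩
  (K * P * x + C) + K * suc (Q * c)     ≤⟨ +-monoʳ-≤ (K * P * x + C) (*-monoʳ-≤ K Qc<Pp) ⟩
  (K * P * x + C) + K * (P * p)         ≡⟨ merge K P x p C ⟩
  K * P * (x + p) + C                   ∎
  where
  open ≤-Reasoning
  split : ∀ K Q H c x p → K * Q * (H + c) + (x + p) ≡ (K * Q * H + x) + (K * (Q * c) + p)
  split = solve-∀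
  merge : ∀ K P x p C → (K * P * x + C) + K * (P * p) ≡ K * P * (x + p) + C
  merge = solve-∀

module CycleDecomposition {m} (a : Fin m → ℕ) (w : ℕ) (a≤1+w : ∀ j → a j ≤ suc w) (P Q : ℕ) where

  K : ℕ
  K = suc m ^ w

  C : ℕ
  C = K * Q * K + K

  SparseCycles : Set
  SparseCycles = ∀ f → Dense a f → ∀ i p → 0 < p → p ≤ K → Repeats f w i p →
                 Q * windowSum (isHoliday ∘ f) i p < P * p

  -- Strong induction on L: beyond K slots, pigeonhole on windows yields a cycle of length p ≤ K;
  -- it is excised, and its c holidays satisfy K Q c + p ≤ K P p because Q c < P p.
  holidays-bound : SparseCycles → ∀ L f → Dense a f →
                   K * Q * windowSum (isHoliday ∘ f) 0 L + L ≤ K * P * L + C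
  holidays-bound sparse = <-rec Bound step
    where
    Bound : ℕ → Set
    Bound L = ∀ f → Dense a f → K * Q * windowSum (isHoliday ∘ f) 0 L + L ≤ K * P * L + C
    open ≤-Reasoning
    step : ∀ L → (∀ {L′} → L′ < L → Bound L′) → Bound L
    step L rec f dense with L ≤? K
    ... | yes L≤K = begin
      K * Q * windowSum (isHoliday ∘ f) 0 L + L ≤⟨ +-mono-≤ (*-monoʳ-≤ (K * Q) (≤-trans holidays≤L L≤K)) L≤K ⟩
      C                                         ≤⟨ m≤n+m C (K * P * L) ⟩
      K * P * L + C                             ∎
      where
      holidays≤L : windowSum (isHoliday ∘ f) 0 L ≤ L
      holidays≤L = windowSum-≤-length (isHoliday-≤-1 ∘ f) 0 L
    ... | no  L≰K with cycle-exists f w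
    ... | i , p , p>0 , i+p≤K , repeats with m≤n⇒∃[o]m+o≡n (≤-trans i+p≤K (<⇒≤ (≰⇒> L≰K)))
    ... | R , refl = begin
      K * Q * windowSum (isHoliday ∘ f) 0 (i + p + R) + (i + p + R)
        ≡⟨ cong₂ (λ h x → K * Q * h + x) (windowSum-excise f i p isHoliday R) (xy∙z≈xz∙y i p R) ⟩
      K * Q * (windowSum (isHoliday ∘ excise f i p) 0 (i + R) + windowSum (isHoliday ∘ f) i p) + (i + R + p)
        ≤⟨ segment-bound p≤K (sparse f dense i p p>0 p≤K repeats)
                         (rec shorter (excise f i p) (excise-dense a≤1+w f i p dense repeats)) ⟩
      K * P * (i + R + p) + C
        ≡⟨ cong (λ x → K * P * x + C) (xy∙z≈xz∙y i R p) ⟩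
      K * P * (i + p + R) + C ∎
      where
      p≤K : p ≤ K
      p≤K = ≤-trans (m≤n+m p i) i+p≤K
      shorter : i + R < i + p + R
      shorter = subst (i + R <_) (xy∙z≈xz∙y i R p) (m<m+n (i + R) p>0)

-- Bounded holiday density

[1+l]*[l∸j]≤l*[1+l∸j] : ∀ l j → j ≤ l → suc l * (l ∸ j) ≤ l * (suc l ∸ j)
[1+l]*[l∸j]≤l*[1+l∸j] l j j≤l with m≤n⇒∃[o]m+o≡n j≤l
... | d , refl rewrite m+n∸m≡n j d | +-∸-assoc 1 (m≤m+n j d) | m+n∸m≡n j d | *-suc (j + d) d =
  +-monoˡ-≤ ((j + d) * d) (m≤n+m d j)

[1+l]^j*[1+l∸j]≤l^j*[1+l] : ∀ l j → j ≤ l → suc l ^ j * (suc l ∸ j) ≤ l ^ j * suc l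
[1+l]^j*[1+l∸j]≤l^j*[1+l] l zero    _    = ≤-refl
[1+l]^j*[1+l∸j]≤l^j*[1+l] l (suc j) j<l = begin
  suc l * suc l ^ j * (l ∸ j)     ≡⟨ *-assoc (suc l) (suc l ^ j) (l ∸ j) ⟩
  suc l * (suc l ^ j * (l ∸ j))   ≡⟨ x*[y*z]≡y*[x*z] (suc l) (suc l ^ j) (l ∸ j) ⟩
  suc l ^ j * (suc l * (l ∸ j))   ≤⟨ *-monoʳ-≤ (suc l ^ j) ([1+l]*[l∸j]≤l*[1+l∸j] l j (<⇒≤ j<l)) ⟩
  suc l ^ j * (l * (suc l ∸ j))   ≡⟨ x*[y*z]≡y*[x*z] (suc l ^ j) l (suc l ∸ j) ⟩
  l * (suc l ^ j * (suc l ∸ j))   ≤⟨ *-monoʳ-≤ l ([1+l]^j*[1+l∸j]≤l^j*[1+l] l j (<⇒≤ j<l)) ⟩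
  l * (l ^ j * suc l)             ≡⟨ *-assoc l (l ^ j) (suc l) ⟨
  l * l ^ j * suc l               ∎
  where open ≤-Reasoning

[1+l]^[l∸1]≤l^l : ∀ l → suc l ^ (l ∸ 1) ≤ l ^ l
[1+l]^[l∸1]≤l^l zero    = ≤-refl
[1+l]^[l∸1]≤l^l (suc k) = *-cancelʳ-≤ (suc (suc k) ^ k) (suc k ^ suc k) 2 (begin
  suc (suc k) ^ k * 2                ≡⟨ cong (λ x → suc (suc k) ^ k * x) (2+k∸k≡2 k) ⟨
  suc (suc k) ^ k * (suc (suc k) ∸ k) ≤⟨ [1+l]^j*[1+l∸j]≤l^j*[1+l] (suc k) k (n≤1+n k) ⟩
  suc k ^ k * suc (suc k)            ≤⟨ *-monoʳ-≤ (suc k ^ k) (2+k≤[1+k]*2 k) ⟩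
  suc k ^ k * (suc k * 2)            ≡⟨ x*[y*z]≡[y*x]*z (suc k ^ k) (suc k) 2 ⟩
  suc k * suc k ^ k * 2              ∎)
  where
  open ≤-Reasoning
  2+k∸k≡2 : ∀ k → suc (suc k) ∸ k ≡ 2
  2+k∸k≡2 zero    = refl
  2+k∸k≡2 (suc k) = 2+k∸k≡2 k
  2+k≤[1+k]*2 : ∀ k → 2 + k ≤ suc k * 2
  2+k≤[1+k]*2 zero    = ≤-refl
  2+k≤[1+k]*2 (suc k) = s≤s (≤-trans (2+k≤[1+k]*2 k) (n≤1+n _))

candidate≤hmax : ∀ {B P h p σ} → IsHMax B P h → Candidate B P p σ → holidayFraction p σ ℚ.≤ h
candidate≤hmax (inj₁ (none , _)) cand = contradiction (_ , _ , cand) none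
candidate≤hmax (inj₂ (_ , max))  cand = max _ _ cand

hmax<D⇒unschedulable : ∀ {A} → All (0 <_) A → ∀ l {h} →
  IsHMax (Abig l A) (l ^ l) h → h <ℚ D (AnotBig l A) → ¬ Schedulable A
hmax<D⇒unschedulable {A} A⁺ l {h} hmax h<D (σ , valid) = <⇒≱ C<L L≤C
  where
  B = Abig l A
  N = AnotBig l A
  B⁺ : All (0 <_) B
  B⁺ = filter⁺ (_≤? l) A⁺
  N⁺ : All (0 <_) N
  N⁺ = filter⁺ (l <?_) A⁺
  periods≤ : ∀ j → period B j ≤ suc (l ∸ 1)
  periods≤ j = ≤-trans (periods-Abig≤ l A j) (m≤n+m∸n l 1)

  open CycleDecomposition (period B) (l ∸ 1) periods≤ (D-numerator N) (product N)

  K≤l^l : K ≤ l ^ l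
  K≤l^l = ≤-trans (^-monoˡ-≤ (l ∸ 1) (s≤s (length-Abig≤ l A⁺ valid))) ([1+l]^[l∸1]≤l^l l)

  sparse : SparseCycles
  sparse f dense i p@(suc p-1) _ p≤K repeats =
    <D⇒product*<D-numerator* N⁺ _ p-1 (ℚₚ.≤-<-trans fraction≤h h<D)
    where
    open PeriodicExtension B f (l ∸ 1) i p repeats
    fraction≤h : + windowSum (isHoliday ∘ f) i p / p ℚ.≤ h
    fraction≤h = subst (λ c → + c / p ℚ.≤ h) extension-holidays (candidate≤hmax {B} hmax
      (s≤s z≤n , ≤-trans p≤K K≤l^l , extension-periodic , extension-valid B⁺ periods≤ dense))

  -- A multiple of product N, so that the holiday count of bigPart-holidays is exactly L · D N.
  L = suc C * product N
  g = bigPart l A⁺ valid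
  H = windowSum (isHoliday ∘ g) 0 L

  lower : K * D-numerator N * L ≤ K * product N * H
  lower = begin
    K * D-numerator N * L                     ≡⟨ swap K (D-numerator N) (product N) (suc C) ⟩
    K * product N * (suc C * D-numerator N)   ≡⟨ cong (λ x → K * product N * x) (sum-floorDiv-product N⁺ (suc C)) ⟨
    K * product N * sum (map (floorDiv L) N)  ≤⟨ *-monoʳ-≤ (K * product N) (bigPart-holidays l A⁺ valid L) ⟩
    K * product N * H                         ∎
    where
    open ≤-Reasoning
    swap : ∀ K P Q c → K * P * (c * Q) ≡ K * Q * (c * P)
    swap = solve-∀

  L≤C : L ≤ C
  L≤C = +-cancelˡ-≤ (K * D-numerator N * L) L C (≤-trans (+-monoˡ-≤ L lower)
          (holidays-bound sparse L g (bigPart-dense l A⁺ valid)))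

  C<L : C < L
  C<L = m≤m*n (suc C) (product N) {{product≢0 (All.map >-nonZero N⁺)}}

lemma4 : (A : Periods) → All (0 <_) A → (ε : ℚ) → (pos : 0ℚ <ℚ ε) → ε <ℚ (+ 2 / 7) →
    PTASOutputsUnschedulable A ε pos → ¬ Schedulable A
lemma4 A A⁺ ε pos _ (inj₁ 1<D) = D>1⇒unschedulable A⁺ 1<D
lemma4 A A⁺ ε pos _ (inj₂ (_ , k , _ , _ , hmax , hmax<D)) =
  hmax<D⇒unschedulable A⁺ (ℓseq (nOf ε pos) k) hmax hmax<D
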